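{- Let $t_1,t_2,\ldots,s_1,s_2,\ldots$ be commuting indeterminates, $T(x)=1+\sum_{i\ge1}t_ix^i$, $S(y)=1+\sum_{i\ge1}s_iy^i$, and $$C_j(x,y;\mathbf{t};\mathbf{s})=\sum_{m,k\ge0}x^my^k\sum_{C\in\mathscr{C}_{m,k,j}}\prod_{i\ge1}t_i^{u_i(C)}\prod_{i\ge1}s_i^{h_i(C)},\qquad C(x,y;\mathbf{t};\mathbf{s};q)=\sum_{j\ge0}q^jC_j(x,y;\mathbf{t};\mathbf{s}).$$ Then $$C(x,y;\mathbf{t};\mathbf{s};q)=\frac{S(qy)}{1+qS(qy)-qS(qy)T(x)}.$$
   Context: A composition of a nonnegative integer $m$ into $j$ parts is an ordered sequence $(\lambda_1,\ldots,\lambda_j)$ of nonnegative integers with $\lambda_1+\cdots+\lambda_j=m$ (for $j=0$ the empty sequence, a composition of $0$). $\mathscr{C}_{m,k,j}$ is the set of compositions of $m$ into $j$ parts exactly $k$ of which are zero. For a composition $C$, $u_i(C)$ is the number of parts equal to $i$ ($i\ge1$), and $h_i(C)$ is the number of maximal runs of consecutive zero parts that have length exactly $i$. (Equivalently: replace each part $\lambda_i\ge1$ by $u^{\lambda_i}d^{\lambda_i}$ and each zero part by $h$ to get a Motzkin path, and count its $u$-segments and $h$-segments, i.e. maximal runs of up-steps resp. horizontal steps, of length $i$.) -}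

module Defs where

open import Level using (Level)
open import Data.Bool using (Bool; true; false; _∧_)
open import Data.Nat using (ℕ; zero; suc; _∸_; _≡ᵇ_)
import Data.Nat as N
open import Data.List using (List; []; _∷_; _++_; map; concatMap; filterᵇ; length; upTo; foldr)
open import Algebra.Bundles using (CommutativeRing)

boundedLists : ℕ → ℕ → List (List ℕ)
boundedLists b zero    = [] ∷ []
boundedLists b (suc j) = concatMap (λ a → map (a ∷_) (boundedLists b j)) (upTo (suc b))

sumL : List ℕ → ℕ
sumL = foldr N._+_ 0

countL : ℕ → List ℕ → ℕ
countL i xs = length (filterᵇ (λ x → x ≡ᵇ i) xs)

-- The set 𝒞_{m,k,j}: compositions of m into j parts, exactly k of them zero.
-- (Every part of a composition of m is ≤ m, so enumerating lists with
-- entries in {0,…,m} and filtering by the defining conditions gives all of them.)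
compositions : ℕ → ℕ → ℕ → List (List ℕ)
compositions m k j =
  filterᵇ (λ C → (sumL C ≡ᵇ m) ∧ (countL 0 C ≡ᵇ k)) (boundedLists m j)

u : ℕ → List ℕ → ℕ
u i C = countL i C

-- lengths of the maximal runs of consecutive zero parts
-- (acc = length of the zero run currently being read)
flush : ℕ → List ℕ
flush zero    = []
flush (suc n) = suc n ∷ []

zeroRunsFrom : ℕ → List ℕ → List ℕ
zeroRunsFrom acc []           = flush acc
zeroRunsFrom acc (zero ∷ xs)  = zeroRunsFrom (suc acc) xs
zeroRunsFrom acc (suc _ ∷ xs) = flush acc ++ zeroRunsFrom 0 xs

zeroRuns : List ℕ → List ℕ
zeroRuns = zeroRunsFrom 0

h : ℕ → List ℕ → ℕ
h i C = countL i (zeroRuns C)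

oneTo : ℕ → List ℕ
oneTo n = map suc (upTo n)

-- Formal power series in x, y, q over a commutative ring R,
-- represented by their coefficient functions: f a b c = [x^a y^b q^c] f.

module _ {c ℓ : Level} (R : CommutativeRing c ℓ) where
  open CommutativeRing R

  Series : Set c
  Series = ℕ → ℕ → ℕ → Carrier

  _≋_ : Series → Series → Set ℓ
  f ≋ g = ∀ a b c → f a b c ≈ g a b c

  pow : Carrier → ℕ → Carrier
  pow x zero    = 1#
  pow x (suc n) = x * pow x n

  Σ[_] : List Carrier → Carrier
  Σ[_] = foldr _+_ 0#

  Π[_] : List Carrier → Carrier
  Π[_] = foldr _*_ 1#

  upToIncl : ℕ → List ℕ
  upToIncl n = upTo (suc n)

  δ : ℕ → ℕ → Carrier
  δ a b with a ≡ᵇ b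
  ... | true  = 1#
  ... | false = 0#

  oneS : Series
  oneS a b c = δ a 0 * (δ b 0 * δ c 0)

  qS : Series
  qS a b c = δ a 0 * (δ b 0 * δ c 1)

  _⊕_ : Series → Series → Series
  (f ⊕ g) a b c = f a b c + g a b c

  ⊖_ : Series → Series
  (⊖ f) a b c = - f a b c

  _⊛_ : Series → Series → Series
  (f ⊛ g) a b c =
    Σ[ concatMap (λ a₁ → concatMap (λ b₁ → map (λ c₁ →
         f a₁ b₁ c₁ * g (a ∸ a₁) (b ∸ b₁) (c ∸ c₁))
       (upToIncl c)) (upToIncl b)) (upToIncl a) ]

  withOne : (ℕ → Carrier) → ℕ → Carrier
  withOne t zero    = 1#
  withOne t (suc i) = t (suc i)

  Tx : (ℕ → Carrier) → Series
  Tx t a b c = withOne t a * (δ b 0 * δ c 0)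

  -- S(qy) = 1 + Σ_{i≥1} s_i q^i y^i
  Sqy : (ℕ → Carrier) → Series
  Sqy s a b c = δ a 0 * (δ b c * withOne s b)

  -- weight of a composition C ∈ 𝒞_{m,k,j}:
  --   ∏_{i≥1} t_i^{u_i(C)} ∏_{i≥1} s_i^{h_i(C)}
  -- (u_i(C) = 0 for i > m and h_i(C) = 0 for i > j, so the products
  --  may be truncated at m resp. j)
  weight : (t s : ℕ → Carrier) → ℕ → ℕ → List ℕ → Carrier
  weight t s m j C =
    Π[ map (λ i → pow (t i) (u i C)) (oneTo m) ] *
    Π[ map (λ i → pow (s i) (h i C)) (oneTo j) ]

  -- C(x,y;t;s;q) = Σ_j q^j Σ_{m,k} x^m y^k Σ_{C ∈ 𝒞_{m,k,j}} weight(C)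
  Cgf : (t s : ℕ → Carrier) → Series
  Cgf t s m k j = Σ[ map (weight t s m j) (compositions m k j) ]

  Denom : (t s : ℕ → Carrier) → Series
  Denom t s = oneS ⊕ ((qS ⊛ Sqy s) ⊕ (⊖ ((qS ⊛ Sqy s) ⊛ Tx t)))

module Submission where

-- Idea: a composition starts with a run of r ≥ 0 zero parts (weight s_r (qy)^r,
-- with s₀ = 1); either nothing follows, or a positive part i (weight t_i x^i q)
-- followed by an arbitrary composition.  Hence C = S(qy) + q S(qy) (T(x) − 1) C,
-- which is the claim.

open import Level using (Level)
open import Function using (_∘_)
open import Data.Bool using (Bool; true; false; T; _∧_; if_then_else_)
open import Data.Bool.Properties using (T-∧; ∧-zeroʳ)
open import Data.Nat
  using (ℕ; zero; suc; _∸_; _≡ᵇ_; _≤_; _<_; z≤n; s≤s; _≟_; _<?_)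
  renaming (_+_ to _+ℕ_)
import Data.Nat.Properties as ℕP
open import Data.Product using (proj₁)
open import Data.Sum using (_⊎_; inj₁; inj₂)
open import Data.List
  using (List; []; _∷_; _++_; map; concatMap; filterᵇ; length; upTo; foldr)
import Data.List.Properties as ListP
open import Data.List.Relation.Unary.All as All using (All; []; _∷_)
import Data.List.Relation.Unary.All.Properties as AllP
open import Function.Bundles using (Equivalence)
open import Relation.Nullary using (yes; no)
open import Relation.Nullary.Decidable using (dec-true; dec-false)
open import Relation.Binary.PropositionalEquality as ≡ using (_≡_; _≢_)
open import Algebra.Bundles using (CommutativeMonoid; CommutativeRing)
open import Defs

module FiniteSums {c ℓ : Level} (M : CommutativeMonoid c ℓ) where
  open CommutativeMonoid M
  open import Relation.Binary.Reasoning.Setoid setoid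
  open import Algebra.Properties.CommutativeSemigroup commutativeSemigroup
    using (interchange)

  ∑ : List Carrier → Carrier
  ∑ = foldr _∙_ ε

  sumTo : ℕ → (ℕ → Carrier) → Carrier
  sumTo zero    f = ε
  sumTo (suc n) f = sumTo n f ∙ f n

  ∑-++ : ∀ xs ys → ∑ (xs ++ ys) ≈ ∑ xs ∙ ∑ ys
  ∑-++ []       ys = sym (identityˡ _)
  ∑-++ (x ∷ xs) ys = trans (∙-congˡ (∑-++ xs ys)) (sym (assoc _ _ _))

  ∑-concatMap : ∀ {a} {A : Set a} (g : A → List Carrier) L →
                ∑ (concatMap g L) ≈ ∑ (map (∑ ∘ g) L)
  ∑-concatMap g []      = refl
  ∑-concatMap g (x ∷ L) = trans (∑-++ (g x) (concatMap g L)) (∙-congˡ (∑-concatMap g L))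

  ∑-cong-All : ∀ {a} {A : Set a} {f g : A → Carrier} {L} →
               All (λ x → f x ≈ g x) L → ∑ (map f L) ≈ ∑ (map g L)
  ∑-cong-All []       = refl
  ∑-cong-All (e ∷ es) = ∙-cong e (∑-cong-All es)

  ∑-cong : ∀ {a} {A : Set a} {f g : A → Carrier} L →
           (∀ x → f x ≈ g x) → ∑ (map f L) ≈ ∑ (map g L)
  ∑-cong L e = ∑-cong-All (All.universal e L)

  ∑-zero : ∀ {a} {A : Set a} {f : A → Carrier} L →
           (∀ x → f x ≈ ε) → ∑ (map f L) ≈ ε
  ∑-zero []      e = refl
  ∑-zero (x ∷ L) e = trans (∙-cong (e x) (∑-zero L e)) (identityˡ ε)

  ∑-distrib : ∀ {a} {A : Set a} (f g : A → Carrier) L →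
              ∑ (map (λ x → f x ∙ g x) L) ≈ ∑ (map f L) ∙ ∑ (map g L)
  ∑-distrib f g []      = sym (identityˡ ε)
  ∑-distrib f g (x ∷ L) = trans (∙-congˡ (∑-distrib f g L)) (interchange _ _ _ _)

  sumTo-head : ∀ n f → sumTo (suc n) f ≈ f 0 ∙ sumTo n (f ∘ suc)
  sumTo-head zero    f = trans (identityˡ _) (sym (identityʳ _))
  sumTo-head (suc n) f = trans (∙-congʳ (sumTo-head n f)) (assoc _ _ _)

  ∑-upTo : ∀ n f → ∑ (map f (upTo n)) ≈ sumTo n f
  ∑-upTo zero    f = refl
  ∑-upTo (suc n) f = begin
    f 0 ∙ ∑ (map f (Data.List.applyUpTo suc n))
      ≡⟨ ≡.cong (λ L → f 0 ∙ ∑ (map f L)) (≡.sym (ListP.map-upTo suc n)) ⟩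
    f 0 ∙ ∑ (map f (map suc (upTo n)))
      ≡⟨ ≡.cong (λ L → f 0 ∙ ∑ L) (≡.sym (ListP.map-∘ (upTo n))) ⟩
    f 0 ∙ ∑ (map (f ∘ suc) (upTo n))  ≈⟨ ∙-congˡ (∑-upTo n (f ∘ suc)) ⟩
    f 0 ∙ sumTo n (f ∘ suc)            ≈⟨ sym (sumTo-head n f) ⟩
    sumTo (suc n) f                    ∎

  sumTo-cong : ∀ n {f g} → (∀ i → i < n → f i ≈ g i) → sumTo n f ≈ sumTo n g
  sumTo-cong zero    e = refl
  sumTo-cong (suc n) e = ∙-cong (sumTo-cong n (λ i i<n → e i (ℕP.m<n⇒m<1+n i<n))) (e n ℕP.≤-refl)

  sumTo-zero : ∀ n {f} → (∀ i → i < n → f i ≈ ε) → sumTo n f ≈ ε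
  sumTo-zero zero    e = refl
  sumTo-zero (suc n) e =
    trans (∙-cong (sumTo-zero n (λ i i<n → e i (ℕP.m<n⇒m<1+n i<n))) (e n ℕP.≤-refl)) (identityˡ ε)

  sumTo-distrib : ∀ n (f g : ℕ → Carrier) →
                  sumTo n (λ i → f i ∙ g i) ≈ sumTo n f ∙ sumTo n g
  sumTo-distrib zero    f g = sym (identityˡ ε)
  sumTo-distrib (suc n) f g = trans (∙-congʳ (sumTo-distrib n f g)) (interchange _ _ _ _)

  sumTo-pick : ∀ n k {f} → k < n → (∀ i → i < n → i ≢ k → f i ≈ ε) → sumTo n f ≈ f k
  sumTo-pick (suc n) k {f} k<1+n e with ℕP.m≤n⇒m<n∨m≡n (ℕP.≤-pred k<1+n)
  ... | inj₁ k<n = trans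
    (∙-cong (sumTo-pick n k k<n (λ i i<n → e i (ℕP.m<n⇒m<1+n i<n)))
            (e n ℕP.≤-refl (λ n≡k → ℕP.<-irrefl (≡.sym n≡k) k<n)))
    (identityʳ _)
  ... | inj₂ ≡.refl = trans
    (∙-congʳ (sumTo-zero n (λ i i<n → e i (ℕP.m<n⇒m<1+n i<n) (ℕP.<⇒≢ i<n))))
    (identityˡ _)

  sumTo-trailing : ∀ m d f → (∀ i → m ≤ i → f i ≈ ε) → sumTo (d +ℕ m) f ≈ sumTo m f
  sumTo-trailing m zero    f e = refl
  sumTo-trailing m (suc d) f e =
    trans (∙-cong (sumTo-trailing m d f e) (e (d +ℕ m) (ℕP.m≤n+m m d))) (identityʳ _)

  sumTo-reverse : ∀ n f → sumTo n f ≈ sumTo n (λ i → f (n ∸ suc i))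
  sumTo-reverse zero    f = refl
  sumTo-reverse (suc n) f = begin
    sumTo n f ∙ f n                          ≈⟨ comm _ _ ⟩
    f n ∙ sumTo n f                          ≈⟨ ∙-congˡ (sumTo-reverse n f) ⟩
    f n ∙ sumTo n (λ i → f (n ∸ suc i))      ≈⟨ sym (sumTo-head n (λ i → f (suc n ∸ suc i))) ⟩
    sumTo (suc n) (λ i → f (suc n ∸ suc i))  ∎

module Development {c ℓ : Level} (R : CommutativeRing c ℓ) where
  open CommutativeRing R hiding (zero)
  open import Relation.Binary.Reasoning.Setoid setoid
  open import Algebra.Properties.Ring ring using (-‿distribˡ-*; -‿distribʳ-*)
  open import Algebra.Properties.AbelianGroup +-abelianGroup using (⁻¹-∙-comm; ε⁻¹≈ε)
  open FiniteSums +-commutativeMonoid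
  -- products are the same sums, taken in the multiplicative monoid
  module Π = FiniteSums *-commutativeMonoid

  ∑-*ˡ : ∀ {a} {A : Set a} k (f : A → Carrier) L → ∑ (map (λ x → k * f x) L) ≈ k * ∑ (map f L)
  ∑-*ˡ k f []      = sym (zeroʳ k)
  ∑-*ˡ k f (x ∷ L) = trans (+-congˡ (∑-*ˡ k f L)) (sym (distribˡ _ _ _))

  sumTo-neg : ∀ n f → sumTo n (λ i → - f i) ≈ - sumTo n f
  sumTo-neg zero    f = sym ε⁻¹≈ε
  sumTo-neg (suc n) f = trans (+-congʳ (sumTo-neg n f)) (⁻¹-∙-comm _ _)

  *-zeroʳ-≈ : ∀ {x y} → y ≈ 0# → x * y ≈ 0#
  *-zeroʳ-≈ {x} e = trans (*-congˡ e) (zeroʳ x)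

  *-zeroˡ-≈ : ∀ {x y} → x ≈ 0# → x * y ≈ 0#
  *-zeroˡ-≈ {y = y} e = trans (*-congʳ e) (zeroˡ y)

  ι : Bool → Carrier
  ι true  = 1#
  ι false = 0#

  ι-guard : ∀ b {x y} → (T b → x ≈ y) → ι b * x ≈ ι b * y
  ι-guard true  e = *-congˡ (e _)
  ι-guard false e = trans (zeroˡ _) (sym (zeroˡ _))

  δ-as-ι : ∀ a b → δ R a b ≡ ι (a ≡ᵇ b)
  δ-as-ι a b with a ≡ᵇ b
  ... | true  = ≡.refl
  ... | false = ≡.refl

  δ-refl : ∀ n → δ R n n ≈ 1#
  δ-refl n = reflexive (≡.trans (δ-as-ι n n) (≡.cong ι (dec-true (n ≟ n) ≡.refl)))

  δ-ne : ∀ {m n} → m ≢ n → δ R m n ≈ 0#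
  δ-ne {m} {n} m≢n = reflexive (≡.trans (δ-as-ι m n) (≡.cong ι (dec-false (m ≟ n) m≢n)))

  ∸≢0 : ∀ {m n} → n ≤ m → n ≢ m → m ∸ n ≢ 0
  ∸≢0 n≤m n≢m = ℕP.m>n⇒m∸n≢0 (ℕP.≤∧≢⇒< n≤m n≢m)

  boxSum : ℕ → ℕ → ℕ → (ℕ → ℕ → ℕ → Carrier) → Carrier
  boxSum a b c F = sumTo (suc a) (λ a₁ → sumTo (suc b) (λ b₁ → sumTo (suc c) (λ c₁ → F a₁ b₁ c₁)))

  convTerm : Series R → Series R → ℕ → ℕ → ℕ → ℕ → ℕ → ℕ → Carrier
  convTerm f g a b c a₁ b₁ c₁ = f a₁ b₁ c₁ * g (a ∸ a₁) (b ∸ b₁) (c ∸ c₁)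

  ⊛-as-boxSum : ∀ f g a b c → _⊛_ R f g a b c ≈ boxSum a b c (convTerm f g a b c)
  ⊛-as-boxSum f g a b c = begin
    ∑ (concatMap row (upTo (suc a)))             ≈⟨ ∑-concatMap row (upTo (suc a)) ⟩
    ∑ (map (∑ ∘ row) (upTo (suc a)))             ≈⟨ ∑-cong (upTo (suc a)) row-sum ⟩
    ∑ (map (λ a₁ → sumTo (suc b) (λ b₁ → sumTo (suc c) (F a₁ b₁))) (upTo (suc a)))
                                                 ≈⟨ ∑-upTo (suc a) _ ⟩
    boxSum a b c (convTerm f g a b c)            ∎
    where
    F = convTerm f g a b c
    column : ℕ → ℕ → List Carrier
    column a₁ b₁ = map (F a₁ b₁) (upTo (suc c))
    row : ℕ → List Carrier
    row a₁ = concatMap (column a₁) (upTo (suc b))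
    row-sum : ∀ a₁ → ∑ (row a₁) ≈ sumTo (suc b) (λ b₁ → sumTo (suc c) (F a₁ b₁))
    row-sum a₁ = trans (∑-concatMap (column a₁) (upTo (suc b)))
      (trans (∑-cong (upTo (suc b)) (λ b₁ → ∑-upTo (suc c) (F a₁ b₁))) (∑-upTo (suc b) _))

  boxSum-cong : ∀ a b c {F G} →
    (∀ a₁ b₁ c₁ → a₁ ≤ a → b₁ ≤ b → c₁ ≤ c → F a₁ b₁ c₁ ≈ G a₁ b₁ c₁) →
    boxSum a b c F ≈ boxSum a b c G
  boxSum-cong a b c e =
    sumTo-cong (suc a) λ a₁ l₁ → sumTo-cong (suc b) λ b₁ l₂ → sumTo-cong (suc c) λ c₁ l₃ →
    e a₁ b₁ c₁ (ℕP.≤-pred l₁) (ℕP.≤-pred l₂) (ℕP.≤-pred l₃)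

  boxSum-+ : ∀ a b c F G → boxSum a b c (λ x y z → F x y z + G x y z) ≈ boxSum a b c F + boxSum a b c G
  boxSum-+ a b c F G = trans
    (sumTo-cong (suc a) λ a₁ _ → trans (sumTo-cong (suc b) λ b₁ _ → sumTo-distrib (suc c) _ _)
                                       (sumTo-distrib (suc b) _ _))
    (sumTo-distrib (suc a) _ _)

  Off : ℕ → ℕ → ℕ → ℕ → ℕ → ℕ → Set
  Off ka kb kc a₁ b₁ c₁ = a₁ ≢ ka ⊎ (b₁ ≢ kb ⊎ c₁ ≢ kc)

  boxSum-pick : ∀ a b c ka kb kc {F} → ka ≤ a → kb ≤ b → kc ≤ c →
    (∀ a₁ b₁ c₁ → a₁ ≤ a → b₁ ≤ b → c₁ ≤ c →
       Off ka kb kc a₁ b₁ c₁ → F a₁ b₁ c₁ ≈ 0#) →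
    boxSum a b c F ≈ F ka kb kc
  boxSum-pick a b c ka kb kc la lb lc e =
    trans (sumTo-pick (suc a) ka (s≤s la) λ a₁ l₁ ne →
             sumTo-zero (suc b) λ b₁ l₂ → sumTo-zero (suc c) λ c₁ l₃ →
               e a₁ b₁ c₁ (ℕP.≤-pred l₁) (ℕP.≤-pred l₂) (ℕP.≤-pred l₃) (inj₁ ne))
    (trans (sumTo-pick (suc b) kb (s≤s lb) λ b₁ l₂ ne → sumTo-zero (suc c) λ c₁ l₃ →
              e ka b₁ c₁ la (ℕP.≤-pred l₂) (ℕP.≤-pred l₃) (inj₂ (inj₁ ne)))
           (sumTo-pick (suc c) kc (s≤s lc) λ c₁ l₃ ne →
              e ka kb c₁ la lb (ℕP.≤-pred l₃) (inj₂ (inj₂ ne))))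

  ⊛-distribˡ : ∀ f g h a b c → _⊛_ R f (_⊕_ R g h) a b c ≈ _⊛_ R f g a b c + _⊛_ R f h a b c
  ⊛-distribˡ f g h a b c = begin
    _⊛_ R f (_⊕_ R g h) a b c                            ≈⟨ ⊛-as-boxSum f (_⊕_ R g h) a b c ⟩
    boxSum a b c (convTerm f (_⊕_ R g h) a b c)           ≈⟨ boxSum-cong a b c (λ _ _ _ _ _ _ → distribˡ _ _ _) ⟩
    boxSum a b c (λ x y z → convTerm f g a b c x y z + convTerm f h a b c x y z)
                                                          ≈⟨ boxSum-+ a b c _ _ ⟩
    boxSum a b c (convTerm f g a b c) + boxSum a b c (convTerm f h a b c)
                          ≈⟨ +-cong (sym (⊛-as-boxSum f g a b c)) (sym (⊛-as-boxSum f h a b c)) ⟩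
    _⊛_ R f g a b c + _⊛_ R f h a b c                     ∎

  ⊛-identityʳ : ∀ f a b c → _⊛_ R f (oneS R) a b c ≈ f a b c
  ⊛-identityʳ f a b c = begin
    _⊛_ R f (oneS R) a b c                      ≈⟨ ⊛-as-boxSum f (oneS R) a b c ⟩
    boxSum a b c (convTerm f (oneS R) a b c)    ≈⟨ boxSum-pick a b c a b c ℕP.≤-refl ℕP.≤-refl ℕP.≤-refl off ⟩
    f a b c * oneS R (a ∸ a) (b ∸ b) (c ∸ c)    ≈⟨ *-congˡ diagonal ⟩
    f a b c * 1#                                ≈⟨ *-identityʳ _ ⟩
    f a b c                                     ∎
    where
    diagonal : oneS R (a ∸ a) (b ∸ b) (c ∸ c) ≈ 1#
    diagonal rewrite ℕP.n∸n≡0 a | ℕP.n∸n≡0 b | ℕP.n∸n≡0 c = trans (*-identityˡ _) (*-identityˡ _)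
    off : ∀ a₁ b₁ c₁ → a₁ ≤ a → b₁ ≤ b → c₁ ≤ c → Off a b c a₁ b₁ c₁ →
          convTerm f (oneS R) a b c a₁ b₁ c₁ ≈ 0#
    off a₁ _  _  la _  _  (inj₁ ne)        = *-zeroʳ-≈ (*-zeroˡ-≈ (δ-ne (∸≢0 la ne)))
    off _  b₁ _  _  lb _  (inj₂ (inj₁ ne)) = *-zeroʳ-≈ (*-zeroʳ-≈ (*-zeroˡ-≈ (δ-ne (∸≢0 lb ne))))
    off _  _  c₁ _  _  lc (inj₂ (inj₂ ne)) = *-zeroʳ-≈ (*-zeroʳ-≈ (*-zeroʳ-≈ (δ-ne (∸≢0 lc ne))))

  qS-shift-zero : ∀ g a b → _⊛_ R (qS R) g a b 0 ≈ 0#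
  qS-shift-zero g a b = trans (⊛-as-boxSum (qS R) g a b 0)
    (sumTo-zero (suc a) λ _ _ → sumTo-zero (suc b) λ _ _ → trans (+-identityˡ _)
       (*-zeroˡ-≈ (*-zeroʳ-≈ (zeroʳ _))))

  qS-shift-suc : ∀ g a b c → _⊛_ R (qS R) g a b (suc c) ≈ g a b c
  qS-shift-suc g a b c = begin
    _⊛_ R (qS R) g a b (suc c)                      ≈⟨ ⊛-as-boxSum (qS R) g a b (suc c) ⟩
    boxSum a b (suc c) (convTerm (qS R) g a b (suc c))
                              ≈⟨ boxSum-pick a b (suc c) 0 0 1 z≤n z≤n (s≤s z≤n) off ⟩
    (1# * (1# * 1#)) * g a b c                      ≈⟨ *-congʳ (trans (*-identityˡ _) (*-identityˡ _)) ⟩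
    1# * g a b c                                    ≈⟨ *-identityˡ _ ⟩
    g a b c                                         ∎
    where
    off : ∀ a₁ b₁ c₁ → a₁ ≤ a → b₁ ≤ b → c₁ ≤ suc c → Off 0 0 1 a₁ b₁ c₁ →
          convTerm (qS R) g a b (suc c) a₁ b₁ c₁ ≈ 0#
    off _ _ _ _ _ _ (inj₁ ne)        = *-zeroˡ-≈ (*-zeroˡ-≈ (δ-ne ne))
    off _ _ _ _ _ _ (inj₂ (inj₁ ne)) = *-zeroˡ-≈ (*-zeroʳ-≈ (*-zeroˡ-≈ (δ-ne ne)))
    off _ _ _ _ _ _ (inj₂ (inj₂ ne)) = *-zeroˡ-≈ (*-zeroʳ-≈ (*-zeroʳ-≈ (δ-ne ne)))

  -- For a list L of numbers ≤ n,
  -- ∏_{i=1}^{n} f_i^{(number of i in L)} is the product over L of f extended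
  -- by f₀ = 1.  This turns the weights of Defs into products over parts/runs.
  pow-countL-∷ : ∀ x r L i →
    pow R x (countL i (r ∷ L)) ≈ (if r ≡ᵇ i then x else 1#) * pow R x (countL i L)
  pow-countL-∷ x r L i with r ≡ᵇ i
  ... | true  = refl
  ... | false = sym (*-identityˡ _)

  ∏-select : ∀ f n r → r ≤ n →
    Π.∑ (map (λ i → if r ≡ᵇ i then f i else 1#) (oneTo n)) ≈ withOne R f r
  ∏-select f n r r≤n = begin
    Π.∑ (map (select r) (map suc (upTo n)))  ≡⟨ ≡.cong Π.∑ (≡.sym (ListP.map-∘ (upTo n))) ⟩
    Π.∑ (map (select r ∘ suc) (upTo n))      ≈⟨ Π.∑-upTo n (select r ∘ suc) ⟩
    Π.sumTo n (select r ∘ suc)               ≈⟨ select-range r r≤n ⟩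
    withOne R f r                            ∎
    where
    select : ℕ → ℕ → Carrier
    select r i = if r ≡ᵇ i then f i else 1#
    select-range : ∀ r → r ≤ n → Π.sumTo n (select r ∘ suc) ≈ withOne R f r
    select-range zero    _   = Π.sumTo-zero n (λ _ _ → refl)
    select-range (suc r) r<n = trans
      (Π.sumTo-pick n r r<n λ i _ i≢r →
         reflexive (≡.cong (λ b → if b then f (suc i) else 1#) (dec-false (r ≟ i) (i≢r ∘ ≡.sym))))
      (reflexive (≡.cong (λ b → if b then f (suc r) else 1#) (dec-true (r ≟ r) ≡.refl)))

  multiplicity-product : ∀ f n L → All (_≤ n) L →
    Π.∑ (map (λ i → pow R (f i) (countL i L)) (oneTo n)) ≈ Π.∑ (map (withOne R f) L)
  multiplicity-product f n []      []           = Π.∑-zero (oneTo n) (λ _ → refl)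
  multiplicity-product f n (r ∷ L) (r≤n ∷ L≤n) = begin
    Π.∑ (map (λ i → pow R (f i) (countL i (r ∷ L))) (oneTo n))
      ≈⟨ Π.∑-cong (oneTo n) (λ i → pow-countL-∷ (f i) r L i) ⟩
    Π.∑ (map (λ i → (if r ≡ᵇ i then f i else 1#) * pow R (f i) (countL i L)) (oneTo n))
      ≈⟨ Π.∑-distrib _ _ (oneTo n) ⟩
    Π.∑ (map (λ i → if r ≡ᵇ i then f i else 1#) (oneTo n)) *
      Π.∑ (map (λ i → pow R (f i) (countL i L)) (oneTo n))
      ≈⟨ *-cong (∏-select f n r r≤n) (multiplicity-product f n L L≤n) ⟩
    withOne R f r * Π.∑ (map (withOne R f) L) ∎

  parts-bounded : ∀ C → All (_≤ sumL C) C
  parts-bounded []      = []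
  parts-bounded (x ∷ C) = ℕP.m≤m+n x (sumL C)
    ∷ All.map (λ y≤ → ℕP.≤-trans y≤ (ℕP.m≤n+m (sumL C) x)) (parts-bounded C)

  zeroRuns-bounded : ∀ acc C → All (_≤ acc +ℕ length C) (zeroRunsFrom acc C)
  zeroRuns-bounded zero      []          = []
  zeroRuns-bounded (suc acc) []          = ℕP.m≤m+n (suc acc) 0 ∷ []
  zeroRuns-bounded acc       (zero ∷ C)  =
    ≡.subst (λ k → All (_≤ k) (zeroRunsFrom (suc acc) C)) (≡.sym (ℕP.+-suc acc (length C)))
            (zeroRuns-bounded (suc acc) C)
  zeroRuns-bounded acc       (suc _ ∷ C) = AllP.++⁺ (flushed acc)
    (All.map (λ y≤ → ℕP.≤-trans y≤ (ℕP.≤-trans (ℕP.n≤1+n _) (ℕP.m≤n+m (suc (length C)) acc)))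
             (zeroRuns-bounded 0 C))
    where
    flushed : ∀ a → All (_≤ a +ℕ suc (length C)) (flush a)
    flushed zero    = []
    flushed (suc a) = ℕP.m≤m+n (suc a) _ ∷ []

  boundedLists-length : ∀ b j → All (λ C → length C ≡ j) (boundedLists b j)
  boundedLists-length b zero    = ≡.refl ∷ []
  boundedLists-length b (suc j) = AllP.concat⁺ (AllP.map⁺ (All.universal
    (λ x → AllP.map⁺ (All.map (≡.cong suc) (boundedLists-length b j))) (upTo (suc b))))

  ∑-boundedLists-suc : ∀ B j (F : List ℕ → Carrier) →
    ∑ (map F (boundedLists B (suc j))) ≈ sumTo (suc B) (λ x → ∑ (map (F ∘ (x ∷_)) (boundedLists B j)))
  ∑-boundedLists-suc B j F = begin
    ∑ (map F (concatMap extend (upTo (suc B))))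
      ≡⟨ ≡.cong ∑ (ListP.map-concatMap F extend (upTo (suc B))) ⟩
    ∑ (concatMap (map F ∘ extend) (upTo (suc B)))
      ≈⟨ ∑-concatMap (map F ∘ extend) (upTo (suc B)) ⟩
    ∑ (map (λ x → ∑ (map F (extend x))) (upTo (suc B)))
      ≡⟨ ≡.cong ∑ (ListP.map-cong (λ x → ≡.cong ∑ (≡.sym (ListP.map-∘ (boundedLists B j))))
                                  (upTo (suc B))) ⟩
    ∑ (map (λ x → ∑ (map (F ∘ (x ∷_)) (boundedLists B j))) (upTo (suc B)))
      ≈⟨ ∑-upTo (suc B) _ ⟩
    sumTo (suc B) (λ x → ∑ (map (F ∘ (x ∷_)) (boundedLists B j))) ∎
    where
    extend : ℕ → List (List ℕ)
    extend x = map (x ∷_) (boundedLists B j)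

  ∑-filter : ∀ {a} {A : Set a} (P : A → Bool) (w : A → Carrier) L →
    ∑ (map w (filterᵇ P L)) ≈ ∑ (map (λ x → ι (P x) * w x) L)
  ∑-filter P w []      = refl
  ∑-filter P w (x ∷ L) with P x
  ... | true  = +-cong (sym (*-identityˡ _)) (∑-filter P w L)
  ... | false = trans (∑-filter P w L) (trans (sym (+-identityˡ _)) (+-congʳ (sym (zeroˡ _))))

  ≡ᵇ-shift : ∀ x y a → x ≤ a → (x +ℕ y ≡ᵇ a) ≡ (y ≡ᵇ a ∸ x)
  ≡ᵇ-shift zero    y a       _       = ≡.refl
  ≡ᵇ-shift (suc x) y (suc a) (s≤s p) = ≡ᵇ-shift x y a p

  ≡ᵇ-too-large : ∀ x y a → a < x → (x +ℕ y ≡ᵇ a) ≡ false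
  ≡ᵇ-too-large x y a a<x =
    dec-false (x +ℕ y ≟ a) (λ eq → ℕP.<⇒≢ (ℕP.<-≤-trans a<x (ℕP.m≤m+n x y)) (≡.sym eq))

  module Specialised (t s : ℕ → Carrier) where
    open import Algebra.Properties.CommutativeSemigroup *-commutativeSemigroup
      using (interchange; x∙yz≈y∙xz; x∙yz≈xz∙y; xy∙z≈y∙zx)

    t′ s′ : ℕ → Carrier
    t′ = withOne R t
    s′ = withOne R s

    weight-factorises : ∀ {m j} C → sumL C ≡ m → length C ≡ j →
      weight R t s m j C ≈ Π.∑ (map t′ C) * Π.∑ (map s′ (zeroRuns C))
    weight-factorises C ≡.refl ≡.refl =
      *-cong (multiplicity-product t (sumL C) C (parts-bounded C))
             (multiplicity-product s (length C) (zeroRuns C) (zeroRuns-bounded 0 C))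

    inClass : ℕ → ℕ → List ℕ → Bool
    inClass a b C = (sumL C ≡ᵇ a) ∧ (countL 0 C ≡ᵇ b)

    -- the weight of C when C ∈ 𝒞_{a,b,|C|}, read after a pending zero run of length acc
    contribution : ℕ → ℕ → ℕ → List ℕ → Carrier
    contribution acc a b C =
      ι (inClass a b C) * (Π.∑ (map t′ C) * Π.∑ (map s′ (zeroRunsFrom acc C)))

    Cgf-as-contributions : ∀ m k j →
      Cgf R t s m k j ≈ ∑ (map (contribution 0 m k) (boundedLists m j))
    Cgf-as-contributions m k j = trans
      (∑-filter (inClass m k) (weight R t s m j) (boundedLists m j))
      (∑-cong-All (All.map
        (λ {C} length≡j → ι-guard (inClass m k C) λ member →
          weight-factorises C (ℕP.≡ᵇ⇒≡ _ _ (proj₁ (Equivalence.to T-∧ member))) length≡j)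
        (boundedLists-length m j)))

    -- Transfer recursion: the total weight of 𝒞_{a,b,c} read after a pending
    -- zero run of length acc, by cases on the first part.
    mutual
      transfer : ℕ → ℕ → ℕ → ℕ → Carrier
      transfer acc a b zero    = ι ((0 ≡ᵇ a) ∧ (0 ≡ᵇ b)) * s′ acc
      transfer acc a b (suc c) = afterZero acc a b c + afterPositive acc a b c

      -- the first part is 0: the pending run grows
      afterZero : ℕ → ℕ → ℕ → ℕ → Carrier
      afterZero acc a zero    c = 0#
      afterZero acc a (suc b) c = transfer (suc acc) a b c

      -- the first part is a − a₁ > 0: the pending run is closed
      afterPositive : ℕ → ℕ → ℕ → ℕ → Carrier
      afterPositive acc a b c = sumTo a (λ a₁ → t′ (a ∸ a₁) * (s′ acc * transfer 0 a₁ b c))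

    contribution-zero-first : ∀ acc a b C →
      contribution acc a (suc b) (0 ∷ C) ≈ contribution (suc acc) a b C
    contribution-zero-first acc a b C = *-congˡ (*-congʳ (*-identityˡ _))

    contribution-zero-excluded : ∀ acc a C → contribution acc a 0 (0 ∷ C) ≈ 0#
    contribution-zero-excluded acc a C = *-zeroˡ-≈ (reflexive (≡.cong ι (∧-zeroʳ (sumL C ≡ᵇ a))))

    closed-run : ∀ acc Z → Π.∑ (map s′ (flush acc ++ Z)) ≈ s′ acc * Π.∑ (map s′ Z)
    closed-run zero      Z = sym (*-identityˡ _)
    closed-run (suc acc) Z = refl

    contribution-positive-first : ∀ acc a b i C → suc i ≤ a →
      contribution acc a b (suc i ∷ C) ≈ t′ (suc i) * (s′ acc * contribution 0 (a ∸ suc i) b C)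
    contribution-positive-first acc a b i C i<a = begin
      ι ((suc i +ℕ sumL C ≡ᵇ a) ∧ zeros) * ((t′ (suc i) * tC) * Π.∑ (map s′ (flush acc ++ runs)))
        ≡⟨ ≡.cong (λ e → ι (e ∧ zeros) * ((t′ (suc i) * tC) * Π.∑ (map s′ (flush acc ++ runs))))
                  (≡ᵇ-shift (suc i) (sumL C) a i<a) ⟩
      ι ((sumL C ≡ᵇ a ∸ suc i) ∧ zeros) * ((t′ (suc i) * tC) * Π.∑ (map s′ (flush acc ++ runs)))
        ≈⟨ *-congˡ (*-congˡ (closed-run acc runs)) ⟩
      ι ((sumL C ≡ᵇ a ∸ suc i) ∧ zeros) * ((t′ (suc i) * tC) * (s′ acc * Π.∑ (map s′ runs)))
        ≈⟨ *-congˡ (interchange _ _ _ _) ⟩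
      ι ((sumL C ≡ᵇ a ∸ suc i) ∧ zeros) * ((t′ (suc i) * s′ acc) * (tC * Π.∑ (map s′ runs)))
        ≈⟨ x∙yz≈y∙xz _ _ _ ⟩
      (t′ (suc i) * s′ acc) * contribution 0 (a ∸ suc i) b C
        ≈⟨ *-assoc _ _ _ ⟩
      t′ (suc i) * (s′ acc * contribution 0 (a ∸ suc i) b C) ∎
      where
      zeros = countL 0 C ≡ᵇ b
      tC    = Π.∑ (map t′ C)
      runs  = zeroRunsFrom 0 C

    contribution-too-large : ∀ acc a b i C → a < suc i → contribution acc a b (suc i ∷ C) ≈ 0#
    contribution-too-large acc a b i C a<1+i = *-zeroˡ-≈
      (reflexive (≡.cong (λ e → ι (e ∧ (countL 0 C ≡ᵇ b))) (≡ᵇ-too-large (suc i) (sumL C) a a<1+i)))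

    Enumerates : ℕ → ℕ → Set ℓ
    Enumerates B c = ∀ acc a b → a ≤ B →
      ∑ (map (contribution acc a b) (boundedLists B c)) ≈ transfer acc a b c

    enumerate-zero-first : ∀ {B c} → Enumerates B c → ∀ acc a b → a ≤ B →
      ∑ (map (contribution acc a b ∘ (0 ∷_)) (boundedLists B c)) ≈ afterZero acc a b c
    enumerate-zero-first {B} {c} IH acc a zero    a≤B =
      ∑-zero (boundedLists B c) (contribution-zero-excluded acc a)
    enumerate-zero-first {B} {c} IH acc a (suc b) a≤B =
      trans (∑-cong (boundedLists B c) (contribution-zero-first acc a b)) (IH (suc acc) a b a≤B)

    enumerate-positive-first : ∀ {B c} → Enumerates B c → ∀ acc a b → a ≤ B →
      sumTo B (λ i → ∑ (map (contribution acc a b ∘ (suc i ∷_)) (boundedLists B c)))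
        ≈ afterPositive acc a b c
    enumerate-positive-first {B} {c} IH acc a b a≤B = begin
      sumTo B G                       ≡⟨ ≡.cong (λ n → sumTo n G) (≡.sym (ℕP.m∸n+n≡m a≤B)) ⟩
      sumTo ((B ∸ a) +ℕ a) G
        ≈⟨ sumTo-trailing a (B ∸ a) G (λ i a≤i → ∑-zero (boundedLists B c)
             (λ C → contribution-too-large acc a b i C (s≤s a≤i))) ⟩
      sumTo a G                       ≈⟨ sumTo-cong a G-closed ⟩
      sumTo a (λ i → g (a ∸ suc i))   ≈⟨ sym (sumTo-reverse a g) ⟩
      afterPositive acc a b c         ∎
      where
      G : ℕ → Carrier
      G i = ∑ (map (contribution acc a b ∘ (suc i ∷_)) (boundedLists B c))
      g : ℕ → Carrier
      g a₁ = t′ (a ∸ a₁) * (s′ acc * transfer 0 a₁ b c)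
      G-closed : ∀ i → i < a → G i ≈ g (a ∸ suc i)
      G-closed i i<a = begin
        G i ≈⟨ ∑-cong (boundedLists B c) (λ C → contribution-positive-first acc a b i C i<a) ⟩
        ∑ (map (λ C → t′ (suc i) * (s′ acc * contribution 0 (a ∸ suc i) b C)) (boundedLists B c))
          ≈⟨ trans (∑-*ˡ (t′ (suc i)) _ (boundedLists B c)) (*-congˡ (∑-*ˡ (s′ acc) _ (boundedLists B c))) ⟩
        t′ (suc i) * (s′ acc * ∑ (map (contribution 0 (a ∸ suc i) b) (boundedLists B c)))
          ≈⟨ *-congˡ (*-congˡ (IH 0 (a ∸ suc i) b (ℕP.≤-trans (ℕP.m∸n≤m a (suc i)) a≤B))) ⟩
        t′ (suc i) * (s′ acc * transfer 0 (a ∸ suc i) b c)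
          ≡⟨ ≡.cong (λ p → t′ p * (s′ acc * transfer 0 (a ∸ suc i) b c))
                    (≡.sym (ℕP.m∸[m∸n]≡n i<a)) ⟩
        g (a ∸ suc i) ∎

    closing-run : ∀ acc → 1# * Π.∑ (map s′ (flush acc)) ≈ s′ acc
    closing-run zero      = *-identityˡ _
    closing-run (suc acc) = trans (*-identityˡ _) (*-identityʳ _)

    enumeration : ∀ B c → Enumerates B c
    enumeration B zero    acc a b _   = trans (+-identityʳ _) (*-congˡ (closing-run acc))
    enumeration B (suc c) acc a b a≤B = begin
      ∑ (map (contribution acc a b) (boundedLists B (suc c)))  ≈⟨ ∑-boundedLists-suc B c _ ⟩
      sumTo (suc B) F                                          ≈⟨ sumTo-head B F ⟩
      F 0 + sumTo B (F ∘ suc)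
        ≈⟨ +-cong (enumerate-zero-first {B} {c} (enumeration B c) acc a b a≤B)
                  (enumerate-positive-first {B} {c} (enumeration B c) acc a b a≤B) ⟩
      transfer acc a b (suc c)                                 ∎
      where
      F : ℕ → Carrier
      F x = ∑ (map (contribution acc a b ∘ (x ∷_)) (boundedLists B c))

    Cgf≈transfer : ∀ m k j → Cgf R t s m k j ≈ transfer 0 m k j
    Cgf≈transfer m k j = trans (Cgf-as-contributions m k j) (enumeration m j 0 m k ℕP.≤-refl)

    below : ℕ → ℕ → Carrier → Carrier
    below r       zero    X = 0#
    below zero    (suc c) X = X
    below (suc r) (suc c) X = below r c X

    below-lt : ∀ r c X → r < c → below r c X ≡ X
    below-lt zero    (suc c) X _       = ≡.refl
    below-lt (suc r) (suc c) X (s≤s p) = below-lt r c X p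

    below-ge : ∀ r c X → c ≤ r → below r c X ≡ 0#
    below-ge r       zero    X _       = ≡.refl
    below-ge (suc r) (suc c) X (s≤s p) = below-ge r c X p

    below-cong : ∀ r c {X Y} → X ≈ Y → below r c X ≈ below r c Y
    below-cong r       zero    e = refl
    below-cong zero    (suc c) e = e
    below-cong (suc r) (suc c) e = below-cong r c e

    below-neg : ∀ r c X → below r c (- X) ≈ - below r c X
    below-neg r       zero    X = sym ε⁻¹≈ε
    below-neg zero    (suc c) X = refl
    below-neg (suc r) (suc c) X = below-neg r c X

    -- 𝒞_{a,b,c} consisting of zero parts only (after a pending run acc)
    onlyZeros : ℕ → ℕ → ℕ → ℕ → Carrier
    onlyZeros acc a b c = ι (a ≡ᵇ 0) * (ι (b ≡ᵇ c) * s′ (acc +ℕ b))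

    -- a first zero run of length b − b₁ < c (joined to the pending run acc),
    -- then the part a − a₁ > 0, then any composition of 𝒞_{a₁,b₁,c−(b−b₁)−1}
    runThenPart : ℕ → ℕ → ℕ → ℕ → ℕ → ℕ → Carrier
    runThenPart acc a b c a₁ b₁ = below (b ∸ b₁) c
      (t′ (a ∸ a₁) * (s′ (acc +ℕ (b ∸ b₁)) * transfer 0 a₁ b₁ (c ∸ suc (b ∸ b₁))))

    firstRun : ℕ → ℕ → ℕ → ℕ → Carrier
    firstRun acc a b c = sumTo a (λ a₁ → sumTo (suc b) (runThenPart acc a b c a₁))

    -- a first run of length r + 1 is the pending run extended by one zero
    runThenPart-extend : ∀ acc a b c a₁ b₁ → b₁ ≤ b →
      runThenPart acc a (suc b) (suc c) a₁ b₁ ≡ runThenPart (suc acc) a b c a₁ b₁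
    runThenPart-extend acc a b c a₁ b₁ b₁≤b
      rewrite ℕP.+-∸-assoc 1 b₁≤b | ℕP.+-suc acc (b ∸ b₁) = ≡.refl

    -- an empty first run: the pending run is closed by the first part
    runThenPart-empty : ∀ acc a b c a₁ →
      runThenPart acc a b (suc c) a₁ b ≈ t′ (a ∸ a₁) * (s′ acc * transfer 0 a₁ b c)
    runThenPart-empty acc a b c a₁ rewrite ℕP.n∸n≡0 b | ℕP.+-identityʳ acc = refl

    onlyZeros-base : ∀ acc a b → ι ((0 ≡ᵇ a) ∧ (0 ≡ᵇ b)) * s′ acc ≈ onlyZeros acc a b 0
    onlyZeros-base acc zero    zero    =
      trans (*-identityˡ _) (sym (trans (*-identityˡ _)
        (trans (*-identityˡ _) (reflexive (≡.cong s′ (ℕP.+-identityʳ acc))))))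
    onlyZeros-base acc zero    (suc b) = trans (zeroˡ _) (sym (trans (*-congˡ (zeroˡ _)) (zeroʳ _)))
    onlyZeros-base acc (suc a) b       = trans (zeroˡ _) (sym (zeroˡ _))

    transfer-first-run : ∀ c acc a b → transfer acc a b c ≈ onlyZeros acc a b c + firstRun acc a b c
    transfer-first-run zero acc a b = begin
      transfer acc a b 0                  ≈⟨ onlyZeros-base acc a b ⟩
      onlyZeros acc a b 0                 ≈⟨ sym (+-identityʳ _) ⟩
      onlyZeros acc a b 0 + 0#            ≈⟨ +-congˡ (sym (sumTo-zero a λ _ _ → sumTo-zero (suc b) λ _ _ → refl)) ⟩
      onlyZeros acc a b 0 + firstRun acc a b 0 ∎
    transfer-first-run (suc c) acc a zero = +-cong
      (sym (*-zeroʳ-≈ (zeroˡ _)))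
      (sumTo-cong a λ a₁ _ → trans (sym (runThenPart-empty acc a 0 c a₁)) (sym (+-identityˡ _)))
    transfer-first-run (suc c) acc a (suc b) = begin
      transfer (suc acc) a b c + afterPositive acc a (suc b) c
        ≈⟨ +-congʳ (transfer-first-run c (suc acc) a b) ⟩
      (onlyZeros (suc acc) a b c + firstRun (suc acc) a b c) + afterPositive acc a (suc b) c
        ≈⟨ +-assoc _ _ _ ⟩
      onlyZeros (suc acc) a b c + (firstRun (suc acc) a b c + afterPositive acc a (suc b) c)
        ≈⟨ +-cong (reflexive (≡.cong (λ n → ι (a ≡ᵇ 0) * (ι (b ≡ᵇ c) * s′ n))
                                     (≡.sym (ℕP.+-suc acc b))))
                  (sym (sumTo-distrib a _ _)) ⟩
      onlyZeros acc a (suc b) (suc c)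
        + sumTo a (λ a₁ → sumTo (suc b) (runThenPart (suc acc) a b c a₁)
                          + t′ (a ∸ a₁) * (s′ acc * transfer 0 a₁ (suc b) c))
        ≈⟨ +-congˡ (sumTo-cong a λ a₁ _ → +-cong
             (sumTo-cong (suc b) λ b₁ b₁<1+b →
               reflexive (≡.sym (runThenPart-extend acc a b c a₁ b₁ (ℕP.≤-pred b₁<1+b))))
             (sym (runThenPart-empty acc a (suc b) c a₁))) ⟩
      onlyZeros acc a (suc b) (suc c) + firstRun acc a (suc b) (suc c) ∎

    Cgf-first-run : ∀ a b c → Cgf R t s a b c ≈ onlyZeros 0 a b c + firstRun 0 a b c
    Cgf-first-run a b c = trans (Cgf≈transfer a b c) (transfer-first-run c 0 a b)

    onlyZeros-Sqy : ∀ a b c → onlyZeros 0 a b c ≡ Sqy R s a b c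
    onlyZeros-Sqy a b c =
      ≡.sym (≡.cong₂ (λ x y → x * (y * s′ b)) (δ-as-ι a 0) (δ-as-ι b c))

    qRun : ℕ → ℕ → Carrier
    qRun b zero    = 0#
    qRun b (suc c) = δ R b c * s′ b

    QS : Series R
    QS = _⊛_ R (qS R) (Sqy R s)

    QS-coeff : ∀ a b c → QS a b c ≈ δ R a 0 * qRun b c
    QS-coeff a b zero    = trans (qS-shift-zero (Sqy R s) a b) (sym (zeroʳ _))
    QS-coeff a b (suc c) = qS-shift-suc (Sqy R s) a b c

    -- QS involves no x, so multiplying by T(x) only attaches t′_a
    QST-coeff : ∀ a b c → _⊛_ R QS (Tx R t) a b c ≈ qRun b c * t′ a
    QST-coeff a b c = begin
      _⊛_ R QS (Tx R t) a b c                         ≈⟨ ⊛-as-boxSum QS (Tx R t) a b c ⟩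
      boxSum a b c (convTerm QS (Tx R t) a b c)
        ≈⟨ boxSum-pick a b c 0 b c z≤n ℕP.≤-refl ℕP.≤-refl off ⟩
      QS 0 b c * (t′ a * (δ R (b ∸ b) 0 * δ R (c ∸ c) 0))
                                                      ≈⟨ *-cong (trans (QS-coeff 0 b c) (*-identityˡ _)) diagonal ⟩
      qRun b c * t′ a                                 ∎
      where
      diagonal : t′ a * (δ R (b ∸ b) 0 * δ R (c ∸ c) 0) ≈ t′ a
      diagonal rewrite ℕP.n∸n≡0 b | ℕP.n∸n≡0 c = trans (*-congˡ (*-identityˡ _)) (*-identityʳ _)
      off : ∀ a₁ b₁ c₁ → a₁ ≤ a → b₁ ≤ b → c₁ ≤ c → Off 0 b c a₁ b₁ c₁ →
            convTerm QS (Tx R t) a b c a₁ b₁ c₁ ≈ 0#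
      off a₁ b₁ c₁ _ _  _  (inj₁ ne)        = *-zeroˡ-≈ (trans (QS-coeff a₁ b₁ c₁) (*-zeroˡ-≈ (δ-ne ne)))
      off a₁ b₁ c₁ _ lb _  (inj₂ (inj₁ ne)) = *-zeroʳ-≈ (*-zeroʳ-≈ (*-zeroˡ-≈ (δ-ne (∸≢0 lb ne))))
      off a₁ b₁ c₁ _ _  lc (inj₂ (inj₂ ne)) = *-zeroʳ-≈ (*-zeroʳ-≈ (*-zeroʳ-≈ (δ-ne (∸≢0 lc ne))))

    Rest : Series R
    Rest = _⊕_ R QS (⊖_ R (_⊛_ R QS (Tx R t)))

    Rest-coeff : ∀ a b c → Rest a b c ≈ qRun b c * (δ R a 0 + - t′ a)
    Rest-coeff a b c = begin
      QS a b c + - (_⊛_ R QS (Tx R t) a b c)    ≈⟨ +-cong (QS-coeff a b c) (-‿cong (QST-coeff a b c)) ⟩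
      δ R a 0 * qRun b c + - (qRun b c * t′ a)  ≈⟨ +-cong (*-comm _ _) (-‿distribʳ-* _ _) ⟩
      qRun b c * δ R a 0 + qRun b c * - t′ a    ≈⟨ sym (distribˡ _ _ _) ⟩
      qRun b c * (δ R a 0 + - t′ a)             ∎

    ∑-qRun : ∀ r c (F : ℕ → Carrier) →
      sumTo (suc c) (λ c₁ → F c₁ * qRun r (c ∸ c₁)) ≈ below r c (F (c ∸ suc r) * s′ r)
    ∑-qRun r c F with r <? c
    ... | yes r<c = begin
      sumTo (suc c) (λ c₁ → F c₁ * qRun r (c ∸ c₁))
        ≈⟨ sumTo-pick (suc c) (c ∸ suc r) (s≤s (ℕP.m∸n≤m c (suc r))) off ⟩
      F (c ∸ suc r) * qRun r (c ∸ (c ∸ suc r))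
        ≡⟨ ≡.cong (λ n → F (c ∸ suc r) * qRun r n) (ℕP.m∸[m∸n]≡n r<c) ⟩
      F (c ∸ suc r) * (δ R r r * s′ r)
        ≈⟨ *-congˡ (trans (*-congʳ (δ-refl r)) (*-identityˡ _)) ⟩
      F (c ∸ suc r) * s′ r
        ≡⟨ ≡.sym (below-lt r c _ r<c) ⟩
      below r c (F (c ∸ suc r) * s′ r) ∎
      where
      off : ∀ c₁ → c₁ < suc c → c₁ ≢ c ∸ suc r → F c₁ * qRun r (c ∸ c₁) ≈ 0#
      off c₁ c₁≤c ne = *-zeroʳ-≈ (qRun-off (c ∸ c₁) λ eq →
        ne (≡.trans (≡.sym (ℕP.m∸[m∸n]≡n (ℕP.≤-pred c₁≤c))) (≡.cong (c ∸_) eq)))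
        where
        qRun-off : ∀ n → n ≢ suc r → qRun r n ≈ 0#
        qRun-off zero    _  = refl
        qRun-off (suc n) ne = *-zeroˡ-≈ (δ-ne (λ eq → ne (≡.cong suc (≡.sym eq))))
    ... | no r≮c = trans
      (sumTo-zero (suc c) λ c₁ _ →
         *-zeroʳ-≈ (qRun-short (ℕP.≤-trans (ℕP.m∸n≤m c c₁) (ℕP.≮⇒≥ r≮c))))
      (reflexive (≡.sym (below-ge r c _ (ℕP.≮⇒≥ r≮c))))
      where
      qRun-short : ∀ {n} → n ≤ r → qRun r n ≈ 0#
      qRun-short {zero}  _   = refl
      qRun-short {suc n} n≤r = *-zeroˡ-≈ (δ-ne (λ r≡n → ℕP.<-irrefl (≡.sym r≡n) n≤r))

    -- (C ⊛ Rest) is minus the first-run part of C: the a₁ = a slice vanishes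
    -- because t′₀ = 1, and for a₁ < a only −t′ survives in Rest.
    C⊛Rest : ∀ a b c → _⊛_ R (Cgf R t s) Rest a b c ≈ - firstRun 0 a b c
    C⊛Rest a b c = begin
      _⊛_ R (Cgf R t s) Rest a b c              ≈⟨ ⊛-as-boxSum (Cgf R t s) Rest a b c ⟩
      boxSum a b c (convTerm (Cgf R t s) Rest a b c)
        ≈⟨ boxSum-cong a b c (λ a₁ b₁ c₁ _ _ _ →
             *-cong (Cgf≈transfer a₁ b₁ c₁) (Rest-coeff (a ∸ a₁) (b ∸ b₁) (c ∸ c₁))) ⟩
      sumTo a slice + slice a
        ≈⟨ +-congˡ (sumTo-zero (suc b) λ _ _ → sumTo-zero (suc c) λ _ _ →
                      *-zeroʳ-≈ (*-zeroʳ-≈ t′₀-cancels)) ⟩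
      sumTo a slice + 0#                        ≈⟨ +-identityʳ _ ⟩
      sumTo a slice
        ≈⟨ sumTo-cong a (λ a₁ a₁<a → sumTo-cong (suc b) λ b₁ _ → slice-term a₁ a₁<a b₁) ⟩
      sumTo a (λ a₁ → sumTo (suc b) (λ b₁ → - runThenPart 0 a b c a₁ b₁))
                                                ≈⟨ sumTo-cong a (λ a₁ _ → sumTo-neg (suc b) (runThenPart 0 a b c a₁)) ⟩
      sumTo a (λ a₁ → - sumTo (suc b) (runThenPart 0 a b c a₁))
                                                ≈⟨ sumTo-neg a _ ⟩
      - firstRun 0 a b c                        ∎
      where
      slice : ℕ → Carrier
      slice a₁ = sumTo (suc b) λ b₁ → sumTo (suc c) λ c₁ →
        transfer 0 a₁ b₁ c₁ * (qRun (b ∸ b₁) (c ∸ c₁) * (δ R (a ∸ a₁) 0 + - t′ (a ∸ a₁)))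

      t′₀-cancels : δ R (a ∸ a) 0 + - t′ (a ∸ a) ≈ 0#
      t′₀-cancels rewrite ℕP.n∸n≡0 a = -‿inverseʳ 1#

      slice-term : ∀ a₁ → a₁ < a → ∀ b₁ →
        sumTo (suc c) (λ c₁ → transfer 0 a₁ b₁ c₁ *
                               (qRun (b ∸ b₁) (c ∸ c₁) * (δ R (a ∸ a₁) 0 + - t′ (a ∸ a₁))))
          ≈ - runThenPart 0 a b c a₁ b₁
      slice-term a₁ a₁<a b₁ = begin
        sumTo (suc c) (λ c₁ → H c₁ * (qRun r (c ∸ c₁) * (δ R (a ∸ a₁) 0 + - t′ (a ∸ a₁))))
          ≈⟨ sumTo-cong (suc c) (λ c₁ _ → trans (*-congˡ (*-congˡ only-t′)) (x∙yz≈xz∙y _ _ _)) ⟩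
        sumTo (suc c) (λ c₁ → (H c₁ * - t′ (a ∸ a₁)) * qRun r (c ∸ c₁))
          ≈⟨ ∑-qRun r c (λ c₁ → H c₁ * - t′ (a ∸ a₁)) ⟩
        below r c ((H (c ∸ suc r) * - t′ (a ∸ a₁)) * s′ r)
          ≈⟨ below-cong r c (rearrange (H (c ∸ suc r)) (t′ (a ∸ a₁)) (s′ r)) ⟩
        below r c (- (t′ (a ∸ a₁) * (s′ r * H (c ∸ suc r))))
          ≈⟨ below-neg r c _ ⟩
        - runThenPart 0 a b c a₁ b₁ ∎
        where
        r = b ∸ b₁
        H : ℕ → Carrier
        H = transfer 0 a₁ b₁
        only-t′ : δ R (a ∸ a₁) 0 + - t′ (a ∸ a₁) ≈ - t′ (a ∸ a₁)
        only-t′ = trans (+-congʳ (δ-ne (∸≢0 (ℕP.<⇒≤ a₁<a) (ℕP.<⇒≢ a₁<a)))) (+-identityˡ _)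
        rearrange : ∀ h x y → (h * - x) * y ≈ - (x * (y * h))
        rearrange h x y = begin
          (h * - x) * y    ≈⟨ *-congʳ (sym (-‿distribʳ-* h x)) ⟩
          (- (h * x)) * y  ≈⟨ sym (-‿distribˡ-* (h * x) y) ⟩
          - ((h * x) * y)  ≈⟨ -‿cong (xy∙z≈y∙zx h x y) ⟩
          - (x * (y * h))  ∎

-- C · Denom = S(qy): split Denom = 1 + Rest; C ⊛ Rest is minus the first-run
-- part of C, so only the single-zero-run part survives, and that is S(qy).
proposition3p1 : {c ℓ : Level} (R : CommutativeRing c ℓ)
    (t s : ℕ → CommutativeRing.Carrier R) →
    _≋_ R (_⊛_ R (Cgf R t s) (Denom R t s)) (Sqy R s)
proposition3p1 R t s a b c = begin
  _⊛_ R C (Denom R t s) a b c                    ≈⟨ ⊛-distribˡ C (oneS R) Rest a b c ⟩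
  _⊛_ R C (oneS R) a b c + _⊛_ R C Rest a b c    ≈⟨ +-cong (⊛-identityʳ C a b c) (C⊛Rest a b c) ⟩
  C a b c + - firstRun 0 a b c                   ≈⟨ +-congʳ (Cgf-first-run a b c) ⟩
  (onlyZeros 0 a b c + firstRun 0 a b c) + - firstRun 0 a b c
                                                 ≈⟨ //-rightDividesʳ (firstRun 0 a b c) (onlyZeros 0 a b c) ⟩
  onlyZeros 0 a b c                              ≡⟨ onlyZeros-Sqy a b c ⟩
  Sqy R s a b c                                  ∎
  where
  open CommutativeRing R
  open Development R
  open Specialised t s
  open import Algebra.Properties.AbelianGroup +-abelianGroup using (//-rightDividesʳ)
  open import Relation.Binary.Reasoning.Setoid setoid
  C : Series R
  C = Cgf R t s
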